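{- Let $k\ge1$ and let $\mathcal{O}$ be an orbit of rowmotion $\rho$ on $\mathcal{J}({\sf V}_k)$ whose corresponding whirling orbit board (under $\phi$) is tiled entirely by one-tailed whorms. Then for every $i$ with $2\le i\le k-1$, the average of $F_i-F_{i+1}$ over $\mathcal{O}$ equals $\frac{3}{k+2}$, where $F_j=\chi_{\ell_j}+\chi_{r_j}+\chi_{c_{j-1}}$.
   Context: ${\sf V}$ has elements $c,\ell,r$ with $c<\ell$, $c<r$; ${\sf V}_k={\sf V}\times[k]$ with product order, $\ell_j=(\ell,j)$, $c_j=(c,j)$, $r_j=(r,j)$; $\chi_s(I)=1$ iff $s\in I$. Rowmotion $\rho$ on order ideals sends $I$ to the order ideal generated by the minimal elements of the complement. $\mathcal{F}_k({\sf V})$ is the set of $f:{\sf V}\to\{0,\dots,k\}$ with $f(\ell),f(r)\le f(c)$; the whirl $w_x$ repeatedly adds $1$ mod $k+1$ to $f(x)$ until the result lies in $\mathcal{F}_k({\sf V})$; $w=w_c\circ w_r\circ w_\ell$. The bijection $\phi:\mathcal{F}_k({\sf V})\to\mathcal{J}({\sf V}_k)$, $\phi(f)=\{(x,j):1\le j\le f(x)\}$, satisfies $\phi\circ w=\rho\circ\phi$, so $\rho$-orbits correspond to $w$-orbits. Orbit board of a $w$-orbit of size $N$: rows $f_0,\dots,f_{N-1}$ with $f_{t+1}=w(f_t)$, indices mod $N$. Whirl elements: pairs $(x,f_t)$. $(y,f_s)$ is whirl-successive to $(x,f_t)$ if (i) $y=x$, $s=t+1$, $f_s(x)=f_t(x)+1$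 (as integers), or (ii) $x$ covers $y$, $s=t$, $f_t(x)=f_t(y)$. Whorms are the classes of the equivalence relation generated by whirl-successiveness; a whorm is one-tailed if it contains whirl elements at exactly one of $\ell,r$. -}

module Defs where

open import Data.Bool using (Bool; true; false; if_then_else_; _∧_; _∨_; not)
open import Data.Nat using (ℕ; zero; suc; _+_; _*_; _≤_; _<_; _≡ᵇ_; _≤ᵇ_)
open import Data.Fin using (Fin; toℕ)
open import Data.List using (List; []; _∷_; map; concatMap; allFin)
open import Data.Bool.ListAction using (all; any)
open import Data.Nat.ListAction using (sum)
open import Data.Maybe using (Maybe; just; nothing)
open import Data.Product using (_×_; _,_; ∃-syntax)
open import Data.Sum using (_⊎_)
open import Data.Integer as ℤ using (ℤ; +_)
open import Relation.Nullary using (¬_)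
open import Relation.Binary.PropositionalEquality using (_≡_)
open import Relation.Binary.Construct.Closure.Equivalence using (EqClosure)

data V : Set where
  c ℓ r : V

leqV : V → V → Bool
leqV c _ = true
leqV ℓ ℓ = true
leqV r r = true
leqV _ _ = false

data CoversV : V → V → Set where
  ℓ⋗c : CoversV ℓ c
  r⋗c : CoversV r c

allV : List V
allV = c ∷ ℓ ∷ r ∷ []

-- V_k = V × [k].  An element (x , j) with j : Fin k stands for
-- (x , toℕ j + 1) ∈ V × {1,…,k}.

Elt : ℕ → Set
Elt k = V × Fin k

elts : (k : ℕ) → List (Elt k)
elts k = concatMap (λ x → map (λ j → (x , j)) (allFin k)) allV

leq : {k : ℕ} → Elt k → Elt k → Bool
leq (x , i) (y , j) = leqV x y ∧ (toℕ i ≤ᵇ toℕ j)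

lt : {k : ℕ} → Elt k → Elt k → Bool
lt a b = leq a b ∧ not (leq b a)

Subset : ℕ → Set
Subset k = Elt k → Bool

IsOrderIdeal : (k : ℕ) → Subset k → Set
IsOrderIdeal k I = ∀ (a b : Elt k) → leq a b ≡ true → I b ≡ true → I a ≡ true

minCompl : {k : ℕ} → Subset k → Elt k → Bool
minCompl {k} I m = not (I m) ∧ all (λ z → not (lt z m) ∨ I z) (elts k)

rowmotion : (k : ℕ) → Subset k → Subset k
rowmotion k I y = any (λ m → minCompl I m ∧ leq y m) (elts k)

iter : {A : Set} → ℕ → (A → A) → A → A
iter zero    g a = a
iter (suc n) g a = g (iter n g a)

ρ^ : (k : ℕ) → ℕ → Subset k → Subset k
ρ^ k t = iter t (rowmotion k)

_≈_ : {k : ℕ} → Subset k → Subset k → Set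
I ≈ J = ∀ y → I y ≡ J y

IsOrbitSize : (k : ℕ) → Subset k → ℕ → Set
IsOrbitSize k I N =
  (1 ≤ N) × (ρ^ k N I ≈ I) × (∀ t → 1 ≤ t → t < N → ¬ (ρ^ k t I ≈ I))

-- Indicator functions χ_{(x,j)}, for j ∈ {1,…,k} (value 0 out of range;
-- only used in range).

toFin : (k j : ℕ) → Maybe (Fin k)
toFin zero    _       = nothing
toFin (suc k) zero    = just Fin.zero
  where import Data.Fin as Fin
toFin (suc k) (suc j) = Data.Maybe.map Fin.suc (toFin k j)
  where import Data.Maybe
        import Data.Fin as Fin

-- position j (1-based) in the chain [k]
pos : (k j : ℕ) → Maybe (Fin k)
pos k zero    = nothing
pos k (suc j) = toFin k j

χ : (k : ℕ) → V → ℕ → Subset k → ℕ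
χ k x j I with pos k j
... | nothing = 0
... | just p  = if I (x , p) then 1 else 0

F : (k : ℕ) → ℕ → Subset k → ℕ
F k zero    I = χ k ℓ zero I + χ k r zero I
F k (suc j) I = χ k ℓ (suc j) I + χ k r (suc j) I + χ k c j I

sumℤ : ℕ → (ℕ → ℤ) → ℤ
sumℤ zero    g = + 0
sumℤ (suc n) g = sumℤ n g ℤ.+ g n

φ⁻¹ : (k : ℕ) → Subset k → V → ℕ
φ⁻¹ k I x = sum (map (λ j → if I (x , j) then 1 else 0) (allFin k))

row : (k : ℕ) → Subset k → ℕ → V → ℕ
row k I t = φ⁻¹ k (ρ^ k t I)

nxt : ℕ → ℕ → ℕ
nxt N t = if suc t ≡ᵇ N then 0 else suc t

-- Whirl elements: (x , t) with x ∈ V and t < N (standing for (x , f_t)).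
WE : Set
WE = V × ℕ

data WhirlSucc (k : ℕ) (I : Subset k) (N : ℕ) : WE → WE → Set where
  same-x : ∀ {x t} → t < N →
           row k I (nxt N t) x ≡ suc (row k I t x) →
           WhirlSucc k I N (x , t) (x , nxt N t)
  cover  : ∀ {x y t} → t < N → CoversV x y →
           row k I t x ≡ row k I t y →
           WhirlSucc k I N (x , t) (y , t)

SameWhorm : (k : ℕ) → Subset k → ℕ → WE → WE → Set
SameWhorm k I N = EqClosure (WhirlSucc k I N)

Touches : (k : ℕ) → Subset k → ℕ → WE → V → Set
Touches k I N e x = ∃[ t ] (t < N × SameWhorm k I N e (x , t))

OneTailed : (k : ℕ) → Subset k → ℕ → WE → Set
OneTailed k I N e =
  (Touches k I N e ℓ × ¬ Touches k I N e r) ⊎ (¬ Touches k I N e ℓ × Touches k I N e r)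

AllOneTailed : (k : ℕ) → Subset k → ℕ → Set
AllOneTailed k I N = ∀ (x : V) (t : ℕ) → t < N → OneTailed k I N (x , t)

{-# OPTIONS --safe #-}
-- Under φ, rowmotion becomes whirling of labellings f = (f c, f ℓ, f r), and F_i − F_{i+1} at φ(f)
-- is hits i f = [f ℓ = i] + [f r = i] + [f c + 1 = i].  Put K = k + 2, ψ(p) = K [i < p] − p and
--   Φ(f) = Σ_{leaves x} (ψ(f x) − [f x = f c] ψ(f c + 1)) + ψ(f c + 1).
-- A column that steps p ↦ p + 1 changes ψ by K [p = i] − 1.  A wrapping centre costs nothing
-- because ψ(k + 2) = 0 for i ≤ k + 1, and a wrapping leaf is paid for by its correction term; the
-- bookkeeping balances provided that after a centre wrap exactly one leaf lands on the new centre.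
-- Hence Φ(w f) = Φ(f) + K · hits i f − 3 unless both leaves of w f equal its centre, and summing
-- over the orbit makes Φ telescope away, leaving K Σ_t (F_i − F_{i+1}) = 3N.  A row whose leaves both
-- equal its centre is what one-tailedness excludes: the whorm through that centre reaches ℓ and r.
module Submission where

open import Defs
open import Data.Nat using (ℕ; _+_; _*_; _≤_; _∸_)
open import Data.Integer as ℤ using (ℤ; +_)
open import Relation.Binary.PropositionalEquality using (_≡_)

open import Data.Bool using (Bool; true; false; not; _∧_; _∨_; if_then_else_)
open import Data.Bool.ListAction using (all; any)
open import Data.Bool.Properties using (T-≡; ¬-not)
open import Data.Fin as Fin using (Fin; toℕ; fromℕ<)
open import Data.Fin.Properties using (toℕ<n; toℕ-fromℕ<)
open import Data.Integer.Properties as ZP using ()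
open import Algebra.Properties.AbelianGroup ZP.+-0-abelianGroup using (∙-cancelʳ)
open import Data.Integer.Tactic.RingSolver using (solve-∀)
open import Data.List using (List; _∷_; map; allFin)
open import Data.List.Properties using (map-tabulate; map-cong)
open import Data.List.Membership.Propositional using (_∈_; lose)
open import Data.List.Membership.Propositional.Properties using (∈-map⁺; ∈-concatMap⁺; ∈-allFin)
open import Data.List.Relation.Unary.All as All using ()
open import Data.List.Relation.Unary.All.Properties using (all⁺; all⁻)
open import Data.List.Relation.Unary.Any using (Any; here; there; satisfied)
open import Data.List.Relation.Unary.Any.Properties using (any⁺; any⁻)
open import Data.Maybe using (just; nothing)
open import Data.Nat using (zero; suc; _<_; _⊔_; z≤n; s≤s; s≤s⁻¹; _≤?_; _<?_; _≟_)
open import Data.Nat.ListAction using (sum)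
open import Data.Nat.Properties
  using (≤-refl; ≤-reflexive; ≤-trans; ≤-antisym; <-trans; <-irrefl; <-cmp; <-≤-trans; ≤-<-trans;
         <⇒≤; <⇒≢; <⇒≱; ≮⇒≥; ≰⇒>; m≤n⇒m≤1+n; m<n⇒m<1+n; m≤n⇒m<n∨m≡n; ≤ᵇ⇒≤; ≤⇒≤ᵇ;
         m≤m⊔n; m≤n⊔m; ⊔-lub; ⊔-sel; m∸n≤m; n≤1+n; +-comm; *-zeroʳ; *-suc; suc-injective)
open import Data.Product using (_×_; _,_; proj₁; proj₂; ∃-syntax)
open import Data.Sum using (_⊎_; inj₁; inj₂; [_,_]′)
open import Function using (_∘_; id)
open import Function.Bundles using (_⇔_; mk⇔; Equivalence)
open import Relation.Binary using (tri<; tri≈; tri>)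
open import Relation.Binary.Construct.Closure.ReflexiveTransitive using (ε; _◅_)
open import Relation.Binary.Construct.Closure.Symmetric using (bwd)
open import Relation.Binary.PropositionalEquality
  using (_≢_; refl; sym; trans; cong; cong₂; subst; subst₂; _≗_; module ≡-Reasoning)
open import Relation.Nullary using (¬_; Dec; yes; no; contradiction)

open Equivalence using (to; from)
open ≡-Reasoning

⟦_⟧ : {P : Set} → Dec P → ℤ
⟦ yes _ ⟧ = + 1
⟦ no  _ ⟧ = + 0

⟦⟧-yes : {P : Set} (d : Dec P) → P → ⟦ d ⟧ ≡ + 1
⟦⟧-yes (yes _) _ = refl
⟦⟧-yes (no ¬p) p = contradiction p ¬p

⟦⟧-no : {P : Set} (d : Dec P) → ¬ P → ⟦ d ⟧ ≡ + 0
⟦⟧-no (yes p) ¬p = contradiction p ¬p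
⟦⟧-no (no _)  _  = refl

⟦⟧-cong : {P Q : Set} → (P → Q) → (Q → P) → (d : Dec P) (e : Dec Q) → ⟦ d ⟧ ≡ ⟦ e ⟧
⟦⟧-cong P→Q Q→P (yes p) e = sym (⟦⟧-yes e (P→Q p))
⟦⟧-cong P→Q Q→P (no ¬p) e = sym (⟦⟧-no e (¬p ∘ Q→P))

x-⟦no⟧*y≡x : {P : Set} (d : Dec P) → ¬ P → ∀ x y → x ℤ.- ⟦ d ⟧ ℤ.* y ≡ x
x-⟦no⟧*y≡x (yes p) ¬p _ _ = contradiction p ¬p
x-⟦no⟧*y≡x (no _)  _  x _ = ZP.+-identityʳ x

x-⟦yes⟧*x≡0 : {P : Set} (d : Dec P) → P → ∀ x → x ℤ.- ⟦ d ⟧ ℤ.* x ≡ + 0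
x-⟦yes⟧*x≡0 (yes _) _ x = trans (cong (λ y → x ℤ.- y) (ZP.*-identityˡ x)) (ZP.+-inverseʳ x)
x-⟦yes⟧*x≡0 (no ¬p) p _ = contradiction p ¬p

⟦≤⟧≡⟦<⟧+⟦≡⟧ : ∀ m n → ⟦ m ≤? n ⟧ ≡ ⟦ m <? n ⟧ ℤ.+ ⟦ n ≟ m ⟧
⟦≤⟧≡⟦<⟧+⟦≡⟧ m n with <-cmp m n
... | tri< m<n m≢n _ =
  trans (⟦⟧-yes (m ≤? n) (<⇒≤ m<n))
        (sym (cong₂ ℤ._+_ (⟦⟧-yes (m <? n) m<n) (⟦⟧-no (n ≟ m) (m≢n ∘ sym))))
... | tri≈ m≮n m≡n _ =
  trans (⟦⟧-yes (m ≤? n) (≤-reflexive m≡n))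
        (sym (cong₂ ℤ._+_ (⟦⟧-no (m <? n) m≮n) (⟦⟧-yes (n ≟ m) (sym m≡n))))
... | tri> _ m≢n n<m =
  trans (⟦⟧-no (m ≤? n) (<⇒≱ n<m))
        (sym (cong₂ ℤ._+_ (⟦⟧-no (m <? n) (<⇒≱ n<m ∘ <⇒≤)) (⟦⟧-no (n ≟ m) (m≢n ∘ sym))))

⟦<⟧-⟦1+<⟧ : ∀ j v → ⟦ j <? v ⟧ ℤ.- ⟦ suc j <? v ⟧ ≡ ⟦ v ≟ suc j ⟧
⟦<⟧-⟦1+<⟧ j v =
  trans (cong (ℤ._- ⟦ suc j <? v ⟧) (⟦≤⟧≡⟦<⟧+⟦≡⟧ (suc j) v))
        (x+y-x≡y ⟦ suc j <? v ⟧ ⟦ v ≟ suc j ⟧)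
  where
    x+y-x≡y : ∀ (x y : ℤ) → x ℤ.+ y ℤ.- x ≡ y
    x+y-x≡y = solve-∀

false≢true : false ≢ true
false≢true ()

indicator≡⟦⟧ : {P : Set} (b : Bool) → b ≡ true ⇔ P → (d : Dec P) → + (if b then 1 else 0) ≡ ⟦ d ⟧
indicator≡⟦⟧ true  b⇔P d = sym (⟦⟧-yes d (to b⇔P refl))
indicator≡⟦⟧ false b⇔P d = sym (⟦⟧-no d (false≢true ∘ from b⇔P))

all≡true⇔ : ∀ {A : Set} (p : A → Bool) {xs : List A} → (∀ x → x ∈ xs) →
  all p xs ≡ true ⇔ (∀ x → p x ≡ true)
all≡true⇔ p {xs} complete = mk⇔
  (λ h x → to T-≡ (All.lookup (all⁺ p xs (from T-≡ h)) (complete x)))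
  (λ h → to T-≡ (all⁻ p {xs} (All.tabulate (λ {x} _ → from T-≡ (h x)))))

any≡true⇔ : ∀ {A : Set} (p : A → Bool) {xs : List A} → (∀ x → x ∈ xs) →
  any p xs ≡ true ⇔ (∃[ x ] p x ≡ true)
any≡true⇔ p {xs} complete = mk⇔
  (λ h → let x , px = satisfied (any⁻ p xs (from T-≡ h)) in x , to T-≡ px)
  (λ (x , px) → to T-≡ (any⁺ p (lose (complete x) (from T-≡ px))))

∧≡true⇔ : ∀ {a b} → a ∧ b ≡ true ⇔ (a ≡ true × b ≡ true)
∧≡true⇔ {true}  {true}  = mk⇔ (λ _ → refl , refl) (λ _ → refl)
∧≡true⇔ {true}  {false} = mk⇔ (λ ()) (λ ())
∧≡true⇔ {false} {_}     = mk⇔ (λ ()) (λ ())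

not∨≡true⇔ : ∀ {a b} → not a ∨ b ≡ true ⇔ (a ≡ true → b ≡ true)
not∨≡true⇔ {true}  = mk⇔ (λ b≡true _ → b≡true) (λ h → h refl)
not∨≡true⇔ {false} = mk⇔ (λ _ ()) (λ _ → refl)

∈-elts : ∀ {k} (e : Elt k) → e ∈ elts k
∈-elts {k} (x , j) = ∈-concatMap⁺ (λ y → map (y ,_) (allFin k)) (column x)
  where
    in-column : ∀ y → (y , j) ∈ map (y ,_) (allFin k)
    in-column y = ∈-map⁺ (y ,_) (∈-allFin j)
    column : ∀ x → Any (λ y → (x , j) ∈ map (y ,_) (allFin k)) allV
    column c = here (in-column c)
    column ℓ = there (here (in-column ℓ))
    column r = there (there (here (in-column r)))

leqV-refl : ∀ x → leqV x x ≡ true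
leqV-refl c = refl
leqV-refl ℓ = refl
leqV-refl r = refl

module _ {k : ℕ} where

  leq⇔ : ∀ x y (i j : Fin k) → leq (x , i) (y , j) ≡ true ⇔ (leqV x y ≡ true × toℕ i ≤ toℕ j)
  leq⇔ x y i j = mk⇔
    (λ h → let x≤y , i≤ᵇj = to ∧≡true⇔ h in x≤y , ≤ᵇ⇒≤ (toℕ i) (toℕ j) (from T-≡ i≤ᵇj))
    (λ (x≤y , i≤j) → from ∧≡true⇔ (x≤y , to T-≡ (≤⇒≤ᵇ i≤j)))

  lt⇔ : ∀ (a b : Elt k) → lt a b ≡ true ⇔ (leq a b ≡ true × leq b a ≡ false)
  lt⇔ a b with leq a b | leq b a
  ... | true  | true  = mk⇔ (λ ()) (λ ())
  ... | true  | false = mk⇔ (λ _ → refl , refl) (λ _ → refl)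
  ... | false | _     = mk⇔ (λ ()) (λ ())

  lt-column⇔ : ∀ x {i j : Fin k} → lt (x , i) (x , j) ≡ true ⇔ toℕ i < toℕ j
  lt-column⇔ x {i} {j} = mk⇔
    (λ h → let _ , j≰i = to (lt⇔ (x , i) (x , j)) h in
             ≰⇒> (λ j≤i → false≢true (trans (sym j≰i) (from (leq⇔ x x j i) (leqV-refl x , j≤i)))))
    (λ i<j → from (lt⇔ (x , i) (x , j))
                  ( from (leq⇔ x x i j) (leqV-refl x , <⇒≤ i<j)
                  , ¬-not (λ j≤i → <⇒≱ i<j (proj₂ (to (leq⇔ x x j i) j≤i)))))

  lt-centre-leaf : ∀ {y} (p : Fin k) → CoversV y c → lt (c , p) (y , p) ≡ true
  lt-centre-leaf p ℓ⋗c = from (lt⇔ (c , p) (ℓ , p)) (from (leq⇔ c ℓ p p) (refl , ≤-refl) , refl)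
  lt-centre-leaf p r⋗c = from (lt⇔ (c , p) (r , p)) (from (leq⇔ c r p p) (refl , ≤-refl) , refl)

  lt-cases : ∀ x y (i j : Fin k) → lt (x , i) (y , j) ≡ true →
    (x ≡ y × toℕ i < toℕ j) ⊎ (x ≡ c × CoversV y c × toℕ i ≤ toℕ j)
  lt-cases x y i j h with to (leq⇔ x y i j) (proj₁ (to (lt⇔ (x , i) (y , j)) h))
  lt-cases c c _ _ h | _ = inj₁ (refl , to (lt-column⇔ c) h)
  lt-cases ℓ ℓ _ _ h | _ = inj₁ (refl , to (lt-column⇔ ℓ) h)
  lt-cases r r _ _ h | _ = inj₁ (refl , to (lt-column⇔ r) h)
  lt-cases c ℓ _ _ h | _ , i≤j = inj₂ (refl , ℓ⋗c , i≤j)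
  lt-cases c r _ _ h | _ , i≤j = inj₂ (refl , r⋗c , i≤j)
  lt-cases ℓ c _ _ h | () , _
  lt-cases ℓ r _ _ h | () , _
  lt-cases r c _ _ h | () , _
  lt-cases r ℓ _ _ h | () , _

minCompl⇔ : ∀ {k} (I : Subset k) (m : Elt k) →
  minCompl I m ≡ true ⇔ (I m ≡ false × (∀ z → lt z m ≡ true → I z ≡ true))
minCompl⇔ {k} I m with I m
... | true  = mk⇔ (λ ()) (λ ())
... | false = mk⇔
  (λ h → refl , λ z → to not∨≡true⇔ (to (all≡true⇔ _ ∈-elts) h z))
  (λ (_ , below) → from (all≡true⇔ _ ∈-elts) (λ z → from not∨≡true⇔ (below z)))

record IsLabelling (k : ℕ) (f : V → ℕ) : Set where
  field
    leaf≤centre : ∀ {x} → CoversV x c → f x ≤ f c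
    centre≤k    : f c ≤ k

  ≤k : ∀ x → f x ≤ k
  ≤k c = centre≤k
  ≤k ℓ = ≤-trans (leaf≤centre ℓ⋗c) centre≤k
  ≤k r = ≤-trans (leaf≤centre r⋗c) centre≤k

  antitone : ∀ {x y} → leqV x y ≡ true → f y ≤ f x
  antitone {c} {c} _ = ≤-refl
  antitone {c} {ℓ} _ = leaf≤centre ℓ⋗c
  antitone {c} {r} _ = leaf≤centre r⋗c
  antitone {ℓ} {ℓ} _ = ≤-refl
  antitone {r} {r} _ = ≤-refl

IsLabelling-≗ : ∀ {k f g} → f ≗ g → IsLabelling k f → IsLabelling k g
IsLabelling-≗ {k} f≗g lab = record
  { leaf≤centre = λ {x} x⋗c → subst₂ _≤_ (f≗g x) (f≗g c) (leaf≤centre x⋗c)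
  ; centre≤k    = subst (_≤ k) (f≗g c) centre≤k
  }
  where open IsLabelling lab

whirlLeaf : ℕ → ℕ → ℕ
whirlLeaf a b with b <? a
... | yes _ = suc b
... | no  _ = 0

whirlCentre : ℕ → ℕ → ℕ → ℕ
whirlCentre k a m with a <? k
... | yes _ = suc a
... | no  _ = m

-- w = w_c ∘ w_r ∘ w_ℓ: a leaf label b under the centre label a steps to b + 1 while b < a and
-- wraps to 0 otherwise; the centre steps to a + 1 while a < k, and otherwise wraps to 0 and
-- climbs to the larger of the new leaf labels.
whirl : ℕ → (V → ℕ) → V → ℕ
whirl k f c = whirlCentre k (f c) (whirlLeaf (f c) (f ℓ) ⊔ whirlLeaf (f c) (f r))
whirl k f ℓ = whirlLeaf (f c) (f ℓ)
whirl k f r = whirlLeaf (f c) (f r)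

whirlLeaf-< : ∀ {a b} → b < a → whirlLeaf a b ≡ suc b
whirlLeaf-< {a} {b} b<a with b <? a
... | yes _   = refl
... | no  b≮a = contradiction b<a b≮a

whirlLeaf-≮ : ∀ {a b} → ¬ b < a → whirlLeaf a b ≡ 0
whirlLeaf-≮ {a} {b} b≮a with b <? a
... | yes b<a = contradiction b<a b≮a
... | no  _   = refl

whirlLeaf-≤ : ∀ {a b} → b ≤ a → whirlLeaf a b ≤ a
whirlLeaf-≤ {a} {b} b≤a with b <? a
... | yes b<a = b<a
... | no  _   = z≤n

whirlCentre-< : ∀ {k a} m → a < k → whirlCentre k a m ≡ suc a
whirlCentre-< {k} {a} _ a<k with a <? k
... | yes _   = refl
... | no  a≮k = contradiction a<k a≮k

whirlCentre-≮ : ∀ {k a} m → ¬ a < k → whirlCentre k a m ≡ m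
whirlCentre-≮ {k} {a} _ a≮k with a <? k
... | yes a<k = contradiction a<k a≮k
... | no  _   = refl

m≤whirlCentre : ∀ {k a m} → m ≤ a → m ≤ whirlCentre k a m
m≤whirlCentre {k} {a} m≤a with a <? k
... | yes _ = m≤n⇒m≤1+n m≤a
... | no  _ = ≤-refl

whirlCentre-≤ : ∀ {k a m} → a ≤ k → m ≤ k → whirlCentre k a m ≤ k
whirlCentre-≤ {k} {a} _ m≤k with a <? k
... | yes a<k = a<k
... | no  _   = m≤k

module _ {k} {f : V → ℕ} (lab : IsLabelling k f) where
  open IsLabelling lab

  whirl-leaf≤ : ∀ {x} → CoversV x c → whirl k f x ≤ f c
  whirl-leaf≤ ℓ⋗c = whirlLeaf-≤ (leaf≤centre ℓ⋗c)
  whirl-leaf≤ r⋗c = whirlLeaf-≤ (leaf≤centre r⋗c)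

  whirl-IsLabelling : IsLabelling k (whirl k f)
  whirl-IsLabelling = record
    { leaf≤centre = λ x⋗c → ≤-trans (leaf≤leaves x⋗c) (m≤whirlCentre leaves≤centre)
    ; centre≤k    = whirlCentre-≤ centre≤k (≤-trans leaves≤centre centre≤k)
    }
    where
      leaves≤centre : whirl k f ℓ ⊔ whirl k f r ≤ f c
      leaves≤centre = ⊔-lub (whirl-leaf≤ ℓ⋗c) (whirl-leaf≤ r⋗c)
      leaf≤leaves : ∀ {x} → CoversV x c → whirl k f x ≤ whirl k f ℓ ⊔ whirl k f r
      leaf≤leaves ℓ⋗c = m≤m⊔n _ _
      leaf≤leaves r⋗c = m≤n⊔m _ _

<-⊔⁻ : ∀ {j m n} → j < m ⊔ n → j < m ⊎ j < n
<-⊔⁻ {j} {m} {n} j<m⊔n =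
  [ (λ e → inj₁ (subst (j <_) e j<m⊔n)) , (λ e → inj₂ (subst (j <_) e j<m⊔n)) ]′ (⊔-sel m n)

whirl-leaf : ∀ {k f y} → CoversV y c → whirl k f y ≡ whirlLeaf (f c) (f y)
whirl-leaf ℓ⋗c = refl
whirl-leaf r⋗c = refl

Represents : (k : ℕ) → Subset k → (V → ℕ) → Set
Represents k I f = ∀ x (j : Fin k) → I (x , j) ≡ true ⇔ toℕ j < f x

Represents-≗ : ∀ {k I f g} → f ≗ g → Represents k I f → Represents k I g
Represents-≗ {I = I} f≗g rep x j = subst (λ v → I (x , j) ≡ true ⇔ toℕ j < v) (f≗g x) (rep x j)

-- The minimal elements of the complement of φ(f).
data Generator {k} (f : V → ℕ) : Elt k → Set where
  centre : ∀ {p} → toℕ p ≡ f c → Generator f (c , p)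
  leaf   : ∀ {x p} → CoversV x c → toℕ p ≡ f x → f x < f c → Generator f (x , p)

Generator-height : ∀ {k f y} {p : Fin k} → Generator f (y , p) → toℕ p ≡ f y
Generator-height (centre p≡a)   = p≡a
Generator-height (leaf _ p≡b _) = p≡b

module _ {k} {I : Subset k} {f : V → ℕ} (rep : Represents k I f) where

  minCompl⇒height : ∀ {y p} → minCompl I (y , p) ≡ true → toℕ p ≡ f y
  minCompl⇒height {y} {p} h = ≤-antisym (≮⇒≥ f≮p) (≮⇒≥ p≮f)
    where
      p∉I = proj₁ (to (minCompl⇔ I (y , p)) h)
      below = proj₂ (to (minCompl⇔ I (y , p)) h)
      p≮f : ¬ toℕ p < f y
      p≮f p<f = false≢true (trans (sym p∉I) (from (rep y p) p<f))
      f≮p : ¬ f y < toℕ p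
      f≮p f<p = <-irrefl q≡f (to (rep y q) (below (y , q) (from (lt-column⇔ y) q<p)))
        where
          f<k = <-trans f<p (toℕ<n p)
          q = fromℕ< f<k
          q≡f = toℕ-fromℕ< f<k
          q<p = subst (_< toℕ p) (sym q≡f) f<p

  minCompl⇒leaf< : ∀ {y p} → CoversV y c → minCompl I (y , p) ≡ true → f y < f c
  minCompl⇒leaf< {y} {p} y⋗c h =
    subst (_< f c) (minCompl⇒height h)
          (to (rep c p) (proj₂ (to (minCompl⇔ I (y , p)) h) (c , p) (lt-centre-leaf p y⋗c)))

  minCompl⇒Generator : ∀ {m} → minCompl I m ≡ true → Generator f m
  minCompl⇒Generator {c , p} h = centre (minCompl⇒height h)
  minCompl⇒Generator {ℓ , p} h = leaf ℓ⋗c (minCompl⇒height h) (minCompl⇒leaf< ℓ⋗c h)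
  minCompl⇒Generator {r , p} h = leaf r⋗c (minCompl⇒height h) (minCompl⇒leaf< r⋗c h)

  Generator⇒minCompl : ∀ {m} → Generator f m → minCompl I m ≡ true
  Generator⇒minCompl {y , p} g = from (minCompl⇔ I (y , p)) (p∉I , below)
    where
      p∉I : I (y , p) ≡ false
      p∉I = ¬-not (λ p∈I → <-irrefl (Generator-height g) (to (rep y p) p∈I))
      under-leaf : ∀ {y} {j p : Fin k} → Generator f (y , p) → CoversV y c →
        toℕ j ≤ toℕ p → toℕ j < f c
      under-leaf (leaf _ p≡b b<a) _ j≤p = ≤-<-trans (subst (_ ≤_) p≡b j≤p) b<a
      below : ∀ z → lt z (y , p) ≡ true → I z ≡ true
      below (x , j) h with lt-cases x y j p h
      ... | inj₁ (refl , j<p)       = from (rep y j) (subst (toℕ j <_) (Generator-height g) j<p)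
      ... | inj₂ (refl , y⋗c , j≤p) = from (rep c j) (under-leaf g y⋗c j≤p)

module _ {k} {f : V → ℕ} (lab : IsLabelling k f) where
  open IsLabelling lab

  Generator⇒<whirl : ∀ {y} {p : Fin k} → Generator f (y , p) → f y < whirl k f y
  Generator⇒<whirl {p = p} (centre p≡a) = ≤-reflexive (sym (whirlCentre-< _ (subst (_< k) p≡a (toℕ<n p))))
  Generator⇒<whirl (leaf y⋗c _ b<a) = ≤-reflexive (sym (trans (whirl-leaf y⋗c) (whirlLeaf-< b<a)))

  below-Generator⇒<whirl : ∀ {x j m} → Generator f m → leq (x , j) m ≡ true → toℕ j < whirl k f x
  below-Generator⇒<whirl {x} {j} {y , p} g h =
    ≤-<-trans (subst (toℕ j ≤_) (Generator-height g) j≤p)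
              (<-≤-trans (Generator⇒<whirl g) (IsLabelling.antitone (whirl-IsLabelling lab) x≤y))
    where
      x≤y = proj₁ (to (leq⇔ x y j p) h)
      j≤p = proj₂ (to (leq⇔ x y j p) h)

  <whirl-leaf⇒below-Generator : ∀ {x y} {j : Fin k} → CoversV y c → leqV x y ≡ true →
    toℕ j < whirl k f y → ∃[ m ] Generator f m × leq (x , j) m ≡ true
  <whirl-leaf⇒below-Generator {x} {y} {j} y⋗c x≤y j<w = go (f y <? f c)
    where
      go : Dec (f y < f c) → ∃[ m ] Generator f m × leq (x , j) m ≡ true
      go (yes b<a) = (y , q) , leaf y⋗c q≡b b<a , from (leq⇔ x y j q) (x≤y , j≤q)
        where
          b<k = <-≤-trans b<a centre≤k
          q = fromℕ< b<k
          q≡b = toℕ-fromℕ< b<k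
          j≤q = subst (toℕ j ≤_) (sym q≡b)
                      (s≤s⁻¹ (subst (toℕ j <_) (trans (whirl-leaf y⋗c) (whirlLeaf-< b<a)) j<w))
      go (no b≮a) = contradiction (subst (toℕ j <_) (trans (whirl-leaf y⋗c) (whirlLeaf-≮ b≮a)) j<w) λ ()

  <whirl⇒below-Generator : ∀ {x} {j : Fin k} → toℕ j < whirl k f x →
    ∃[ m ] Generator f m × leq (x , j) m ≡ true
  <whirl⇒below-Generator {ℓ} = <whirl-leaf⇒below-Generator {x = ℓ} ℓ⋗c refl
  <whirl⇒below-Generator {r} = <whirl-leaf⇒below-Generator {x = r} r⋗c refl
  <whirl⇒below-Generator {c} {j} j<w = go (f c <? k)
    where
      go : Dec (f c < k) → ∃[ m ] Generator f m × leq (c , j) m ≡ true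
      go (yes a<k) = (c , q) , centre q≡a , from (leq⇔ c c j q) (refl , j≤q)
        where
          q = fromℕ< a<k
          q≡a = toℕ-fromℕ< a<k
          j≤q = subst (toℕ j ≤_) (sym q≡a) (s≤s⁻¹ (subst (toℕ j <_) (whirlCentre-< _ a<k) j<w))
      go (no a≮k) =
        [ <whirl-leaf⇒below-Generator {x = c} ℓ⋗c refl , <whirl-leaf⇒below-Generator {x = c} r⋗c refl ]′
          (<-⊔⁻ (subst (toℕ j <_) (whirlCentre-≮ _ a≮k) j<w))

rowmotion-Represents : ∀ {k I f} → IsLabelling k f → Represents k I f →
  Represents k (rowmotion k I) (whirl k f)
rowmotion-Represents {k} {I} {f} lab rep x j = mk⇔
  (λ h → let m , h′ = to (any≡true⇔ generates ∈-elts) h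
             mc , x≤m = to ∧≡true⇔ h′
         in below-Generator⇒<whirl lab {x} (minCompl⇒Generator rep mc) x≤m)
  (λ j<w → let m , g , x≤m = <whirl⇒below-Generator lab {x} j<w
           in from (any≡true⇔ generates ∈-elts) (m , from ∧≡true⇔ (Generator⇒minCompl rep g , x≤m)))
  where
    generates : Elt k → Bool
    generates m = minCompl I m ∧ leq (x , j) m

count : ∀ {k} → (Fin k → Bool) → ℕ
count {k} P = sum (map (λ j → if P j then 1 else 0) (allFin k))

map-allFin-suc : ∀ {A : Set} {n} (h : Fin (suc n) → A) →
  map h (allFin (suc n)) ≡ h Fin.zero ∷ map (h ∘ Fin.suc) (allFin n)
map-allFin-suc h =
  cong (h Fin.zero ∷_) (trans (map-tabulate Fin.suc h) (sym (map-tabulate id (h ∘ Fin.suc))))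

count-threshold : ∀ {k} (P : Fin k → Bool) {v} → v ≤ k → (∀ j → P j ≡ true ⇔ toℕ j < v) →
  count P ≡ v
count-threshold {zero} P z≤n _ = refl
count-threshold {suc k} P {zero} _ P⇔ =
  trans (cong sum (map-allFin-suc (λ j → if P j then 1 else 0)))
        (cong₂ _+_ (cong (λ b → if b then 1 else 0) P₀≡false) (count-threshold (P ∘ Fin.suc) z≤n tail⇔))
  where
    P₀≡false : P Fin.zero ≡ false
    P₀≡false = ¬-not (λ P₀ → contradiction (to (P⇔ Fin.zero) P₀) λ ())
    tail⇔ : ∀ j → P (Fin.suc j) ≡ true ⇔ toℕ j < 0
    tail⇔ j = mk⇔ (λ Pj → contradiction (to (P⇔ (Fin.suc j)) Pj) λ ()) (λ ())
count-threshold {suc k} P {suc v} v≤k P⇔ =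
  trans (cong sum (map-allFin-suc (λ j → if P j then 1 else 0)))
        (cong₂ _+_ (cong (λ b → if b then 1 else 0) (from (P⇔ Fin.zero) (s≤s z≤n)))
                   (count-threshold (P ∘ Fin.suc) (s≤s⁻¹ v≤k) tail⇔))
  where
    tail⇔ : ∀ j → P (Fin.suc j) ≡ true ⇔ toℕ j < v
    tail⇔ j = mk⇔ (s≤s⁻¹ ∘ to (P⇔ (Fin.suc j))) (from (P⇔ (Fin.suc j)) ∘ s≤s)

down-closed⇒threshold : ∀ {k} (P : Fin k → Bool) →
  (∀ {i j} → toℕ i ≤ toℕ j → P j ≡ true → P i ≡ true) →
  ∃[ v ] v ≤ k × (∀ j → P j ≡ true ⇔ toℕ j < v)
down-closed⇒threshold {zero} P _ = 0 , z≤n , λ ()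
down-closed⇒threshold {suc k} P down with P Fin.zero in P₀
... | false =
  0 , z≤n , λ j → mk⇔ (λ Pj → contradiction (trans (sym P₀) (down z≤n Pj)) false≢true) (λ ())
... | true  = suc v , s≤s v≤k , P⇔
  where
    tail = down-closed⇒threshold (P ∘ Fin.suc) (λ i≤j → down (s≤s i≤j))
    v = proj₁ tail
    v≤k = proj₁ (proj₂ tail)
    P⇔ : ∀ j → P j ≡ true ⇔ toℕ j < suc v
    P⇔ Fin.zero    = mk⇔ (λ _ → s≤s z≤n) (λ _ → P₀)
    P⇔ (Fin.suc j) = mk⇔ (s≤s ∘ to (proj₂ (proj₂ tail) j)) (from (proj₂ (proj₂ tail) j) ∘ s≤s⁻¹)

module _ {k} {I : Subset k} (ideal : IsOrderIdeal k I) where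

  ideal-column : ∀ x → φ⁻¹ k I x ≤ k × (∀ j → I (x , j) ≡ true ⇔ toℕ j < φ⁻¹ k I x)
  ideal-column x =
    subst (_≤ k) (sym φ⁻¹≡v) v≤k , λ j → subst (λ u → I (x , j) ≡ true ⇔ toℕ j < u) (sym φ⁻¹≡v) (I⇔ j)
    where
      threshold = down-closed⇒threshold (λ j → I (x , j))
        (λ {i} {j} i≤j → ideal (x , i) (x , j) (from (leq⇔ x x i j) (leqV-refl x , i≤j)))
      v = proj₁ threshold
      v≤k = proj₁ (proj₂ threshold)
      I⇔ = proj₂ (proj₂ threshold)
      φ⁻¹≡v = count-threshold (λ j → I (x , j)) v≤k I⇔

  ideal⇒Represents : Represents k I (φ⁻¹ k I)
  ideal⇒Represents x = proj₂ (ideal-column x)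

  ideal⇒IsLabelling : IsLabelling k (φ⁻¹ k I)
  ideal⇒IsLabelling = record { leaf≤centre = leaf≤centre ; centre≤k = proj₁ (ideal-column c) }
    where
      f = φ⁻¹ k I
      leaf≤centre : ∀ {x} → CoversV x c → f x ≤ f c
      leaf≤centre {x} _ = ≮⇒≥ λ a<b →
        let a<k = <-≤-trans a<b (proj₁ (ideal-column x))
            q = fromℕ< a<k
            q≡a = toℕ-fromℕ< a<k
            xq∈I = from (ideal⇒Represents x q) (subst (_< f x) (sym q≡a) a<b)
            cq∈I = ideal (c , q) (x , q) (from (leq⇔ c x q q) (refl , ≤-refl)) xq∈I
        in <-irrefl q≡a (to (ideal⇒Represents c q) cq∈I)

represented⇒φ⁻¹ : ∀ {k J f} → Represents k J f → IsLabelling k f → φ⁻¹ k J ≗ f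
represented⇒φ⁻¹ rep lab x = count-threshold _ (IsLabelling.≤k lab x) (rep x)

φ⁻¹-rowmotion : ∀ {k J f} → Represents k J f → IsLabelling k f → φ⁻¹ k (rowmotion k J) ≗ whirl k f
φ⁻¹-rowmotion rep lab = represented⇒φ⁻¹ (rowmotion-Represents lab rep) (whirl-IsLabelling lab)

φ⁻¹-cong : ∀ {k} {J J′ : Subset k} → J ≈ J′ → φ⁻¹ k J ≗ φ⁻¹ k J′
φ⁻¹-cong {k} J≈J′ x =
  cong sum (map-cong (λ j → cong (λ b → if b then 1 else 0) (J≈J′ (x , j))) (allFin k))

toFin-< : ∀ {k j} (j<k : j < k) → toFin k j ≡ just (fromℕ< j<k)
toFin-< {suc k} {zero}  _   = refl
toFin-< {suc k} {suc j} j<k rewrite toFin-< (s≤s⁻¹ j<k) = refl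

toFin-≥ : ∀ {k j} → k ≤ j → toFin k j ≡ nothing
toFin-≥ {zero}  _         = refl
toFin-≥ {suc k} (s≤s k≤j) rewrite toFin-≥ k≤j = refl

χ-Represents : ∀ {k J f x} → Represents k J f → f x ≤ k → ∀ j → + χ k x (suc j) J ≡ ⟦ j <? f x ⟧
χ-Represents {k} {J} {f} {x} rep fx≤k j with j <? k
... | no j≮k rewrite toFin-≥ (≮⇒≥ j≮k) = sym (⟦⟧-no (j <? f x) (λ j<f → j≮k (<-≤-trans j<f fx≤k)))
... | yes j<k rewrite toFin-< j<k =
  indicator≡⟦⟧ (J (x , q)) (subst (λ n → J (x , q) ≡ true ⇔ n < f x) (toℕ-fromℕ< j<k) (rep x q)) (j <? f x)
  where q = fromℕ< j<k

hits : ℕ → (V → ℕ) → ℤ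
hits i f = ⟦ f ℓ ≟ i ⟧ ℤ.+ ⟦ f r ≟ i ⟧ ℤ.+ ⟦ suc (f c) ≟ i ⟧

module _ {k J f} (rep : Represents k J f) (lab : IsLabelling k f) where
  open IsLabelling lab

  +F≡ : ∀ j → + F k (suc (suc j)) J ≡ ⟦ suc j <? f ℓ ⟧ ℤ.+ ⟦ suc j <? f r ⟧ ℤ.+ ⟦ j <? f c ⟧
  +F≡ j = begin
    + (χ k ℓ (2 + j) J + χ k r (2 + j) J + χ k c (suc j) J)
      ≡⟨ ZP.pos-+ (χ k ℓ (2 + j) J + χ k r (2 + j) J) _ ⟩
    + (χ k ℓ (2 + j) J + χ k r (2 + j) J) ℤ.+ + χ k c (suc j) J
      ≡⟨ cong (ℤ._+ + χ k c (suc j) J) (ZP.pos-+ (χ k ℓ (2 + j) J) _) ⟩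
    + χ k ℓ (2 + j) J ℤ.+ + χ k r (2 + j) J ℤ.+ + χ k c (suc j) J
      ≡⟨ cong₂ ℤ._+_ (cong₂ ℤ._+_ (χ-Represents rep (≤k ℓ) (suc j)) (χ-Represents rep (≤k r) (suc j)))
                     (χ-Represents rep (≤k c) j) ⟩
    ⟦ suc j <? f ℓ ⟧ ℤ.+ ⟦ suc j <? f r ⟧ ℤ.+ ⟦ j <? f c ⟧ ∎

  F-difference : ∀ {i} → 2 ≤ i → + F k i J ℤ.- + F k (i + 1) J ≡ hits i f
  F-difference {suc (suc m)} (s≤s (s≤s z≤n)) = begin
    + F k (2 + m) J ℤ.- + F k (2 + m + 1) J
      ≡⟨ cong (λ n → + F k (2 + m) J ℤ.- + F k n J) (+-comm (2 + m) 1) ⟩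
    + F k (2 + m) J ℤ.- + F k (3 + m) J
      ≡⟨ cong₂ ℤ._-_ (+F≡ m) (+F≡ (suc m)) ⟩
    (Lb ℤ.+ Ld ℤ.+ La) ℤ.- (Lb′ ℤ.+ Ld′ ℤ.+ La′)
      ≡⟨ pair-up Lb Ld La Lb′ Ld′ La′ ⟩
    (Lb ℤ.- Lb′) ℤ.+ (Ld ℤ.- Ld′) ℤ.+ (La ℤ.- La′)
      ≡⟨ cong₂ ℤ._+_ (cong₂ ℤ._+_ (⟦<⟧-⟦1+<⟧ (suc m) b) (⟦<⟧-⟦1+<⟧ (suc m) d))
                     (trans (⟦<⟧-⟦1+<⟧ m a) (⟦⟧-cong (cong suc) suc-injective (a ≟ suc m) (suc a ≟ 2 + m))) ⟩
    hits (2 + m) f ∎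
    where
      a = f c
      b = f ℓ
      d = f r
      Lb = ⟦ suc m <? b ⟧
      Ld = ⟦ suc m <? d ⟧
      La = ⟦ m <? a ⟧
      Lb′ = ⟦ 2 + m <? b ⟧
      Ld′ = ⟦ 2 + m <? d ⟧
      La′ = ⟦ suc m <? a ⟧
      pair-up : ∀ (x y z x′ y′ z′ : ℤ) →
        (x ℤ.+ y ℤ.+ z) ℤ.- (x′ ℤ.+ y′ ℤ.+ z′) ≡ (x ℤ.- x′) ℤ.+ (y ℤ.- y′) ℤ.+ (z ℤ.- z′)
      pair-up = solve-∀

Double : (V → ℕ) → Set
Double f = f ℓ ≡ f c × f r ≡ f c

Double-≗ : ∀ {f g} → f ≗ g → Double f → Double g
Double-≗ f≗g (ℓ≡c , r≡c) =
  trans (sym (f≗g ℓ)) (trans ℓ≡c (f≗g c)) , trans (sym (f≗g r)) (trans r≡c (f≗g c))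

-- After a step the centre sits at a leaf label exactly when it wrapped, and then at the larger one.
centre-wraps-once : ∀ {k f} → IsLabelling k f → ¬ Double (whirl k f) →
  ⟦ f c ≟ k ⟧ ≡ ⟦ whirl k f ℓ ≟ whirl k f c ⟧ ℤ.+ ⟦ whirl k f r ≟ whirl k f c ⟧
centre-wraps-once {k} {f} lab ¬double = wraps (m≤n⇒m<n∨m≡n centre≤k)
  where
    open IsLabelling lab
    M = whirl k f ℓ ⊔ whirl k f r
    leaf≢centre : ∀ {x} → f c < k → CoversV x c → whirl k f x ≢ whirl k f c
    leaf≢centre {x} a<k x⋗c =
      <⇒≢ (subst (whirl k f x <_) (sym (whirlCentre-< _ a<k)) (s≤s (whirl-leaf≤ lab x⋗c)))
    centre-at-max : f c ≡ k → M ≡ whirl k f ℓ ⊎ M ≡ whirl k f r →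
      + 1 ≡ ⟦ whirl k f ℓ ≟ whirl k f c ⟧ ℤ.+ ⟦ whirl k f r ≟ whirl k f c ⟧
    centre-at-max a≡k (inj₁ M≡ℓ) =
      sym (cong₂ ℤ._+_ (⟦⟧-yes (whirl k f ℓ ≟ _) ℓ≡c)
                       (⟦⟧-no (whirl k f r ≟ _) (λ r≡c → ¬double (ℓ≡c , r≡c))))
      where ℓ≡c = sym (trans (whirlCentre-≮ _ (<-irrefl a≡k)) M≡ℓ)
    centre-at-max a≡k (inj₂ M≡r) =
      sym (cong₂ ℤ._+_ (⟦⟧-no (whirl k f ℓ ≟ _) (λ ℓ≡c → ¬double (ℓ≡c , r≡c)))
                       (⟦⟧-yes (whirl k f r ≟ _) r≡c))
      where r≡c = sym (trans (whirlCentre-≮ _ (<-irrefl a≡k)) M≡r)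
    wraps : f c < k ⊎ f c ≡ k →
      ⟦ f c ≟ k ⟧ ≡ ⟦ whirl k f ℓ ≟ whirl k f c ⟧ ℤ.+ ⟦ whirl k f r ≟ whirl k f c ⟧
    wraps (inj₁ a<k) =
      trans (⟦⟧-no (f c ≟ k) (<⇒≢ a<k))
            (sym (cong₂ ℤ._+_ (⟦⟧-no (whirl k f ℓ ≟ _) (leaf≢centre a<k ℓ⋗c))
                              (⟦⟧-no (whirl k f r ≟ _) (leaf≢centre a<k r⋗c))))
    wraps (inj₂ a≡k) =
      trans (⟦⟧-yes (f c ≟ k) a≡k) (centre-at-max a≡k (⊔-sel (whirl k f ℓ) (whirl k f r)))

module Potential (K : ℤ) (i : ℕ) where

  ψ : ℕ → ℤ
  ψ p = K ℤ.* ⟦ i <? p ⟧ ℤ.- + p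

  ψ-suc : ∀ p → ψ (suc p) ≡ ψ p ℤ.+ K ℤ.* ⟦ p ≟ i ⟧ ℤ.- + 1
  ψ-suc p = begin
    K ℤ.* ⟦ i <? suc p ⟧ ℤ.- + suc p
      ≡⟨ cong₂ (λ u v → K ℤ.* u ℤ.- v) ⟦i<1+p⟧ (ZP.pos-+ 1 p) ⟩
    K ℤ.* (⟦ i <? p ⟧ ℤ.+ ⟦ p ≟ i ⟧) ℤ.- (+ 1 ℤ.+ + p)
      ≡⟨ distribute K ⟦ i <? p ⟧ ⟦ p ≟ i ⟧ (+ p) ⟩
    K ℤ.* ⟦ i <? p ⟧ ℤ.- + p ℤ.+ K ℤ.* ⟦ p ≟ i ⟧ ℤ.- + 1 ∎
    where
      ⟦i<1+p⟧ : ⟦ i <? suc p ⟧ ≡ ⟦ i <? p ⟧ ℤ.+ ⟦ p ≟ i ⟧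
      ⟦i<1+p⟧ = trans (⟦⟧-cong s≤s⁻¹ s≤s (i <? suc p) (i ≤? p)) (⟦≤⟧≡⟦<⟧+⟦≡⟧ i p)
      distribute : ∀ (K A B P : ℤ) → K ℤ.* (A ℤ.+ B) ℤ.- (+ 1 ℤ.+ P) ≡ K ℤ.* A ℤ.- P ℤ.+ K ℤ.* B ℤ.- + 1
      distribute = solve-∀

  -- A leaf at the centre label is about to wrap to 0; the correction term anticipates that jump.
  leafTerm : ℕ → ℕ → ℤ
  leafTerm a b = ψ b ℤ.- ⟦ b ≟ a ⟧ ℤ.* ψ (suc a)

  potential : (V → ℕ) → ℤ
  potential f = leafTerm (f c) (f ℓ) ℤ.+ leafTerm (f c) (f r) ℤ.+ ψ (suc (f c))

  potential-≗ : ∀ {f g} → f ≗ g → potential f ≡ potential g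
  potential-≗ f≗g =
    cong₂ ℤ._+_ (cong₂ ℤ._+_ (cong₂ leafTerm (f≗g c) (f≗g ℓ)) (cong₂ leafTerm (f≗g c) (f≗g r)))
                (cong (ψ ∘ suc) (f≗g c))

  ψ-whirlLeaf : ∀ {a b} → b ≤ a → ψ (whirlLeaf a b) ≡ ψ (suc b) ℤ.- ⟦ b ≟ a ⟧ ℤ.* ψ (suc a)
  ψ-whirlLeaf {a} {b} b≤a with m≤n⇒m<n∨m≡n b≤a
  ... | inj₁ b<a = begin
    ψ (whirlLeaf a b)                      ≡⟨ cong ψ (whirlLeaf-< b<a) ⟩
    ψ (suc b)                              ≡⟨ x-⟦no⟧*y≡x (b ≟ a) (<⇒≢ b<a) (ψ (suc b)) (ψ (suc a)) ⟨
    ψ (suc b) ℤ.- ⟦ b ≟ a ⟧ ℤ.* ψ (suc a)  ∎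
  ... | inj₂ refl = begin
    ψ (whirlLeaf b b)                      ≡⟨ cong ψ (whirlLeaf-≮ (<-irrefl refl)) ⟩
    ψ 0                                    ≡⟨ ψ-zero ⟩
    + 0                                    ≡⟨ x-⟦yes⟧*x≡0 (b ≟ b) refl (ψ (suc b)) ⟨
    ψ (suc b) ℤ.- ⟦ b ≟ b ⟧ ℤ.* ψ (suc b)  ∎
    where
      ψ-zero : ψ 0 ≡ + 0
      ψ-zero rewrite ⟦⟧-no (i <? 0) (λ ()) = cong (ℤ._+ + 0) (ZP.*-zeroʳ K)

  ψ-whirlCentre : ∀ {k a} m → ψ (suc (suc k)) ≡ + 0 → a ≤ k →
    ψ (suc (whirlCentre k a m)) ℤ.- ⟦ a ≟ k ⟧ ℤ.* ψ (suc (whirlCentre k a m)) ≡ ψ (suc (suc a))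
  ψ-whirlCentre {k} {a} m ψ[2+k]≡0 a≤k with m≤n⇒m<n∨m≡n a≤k
  ... | inj₁ a<k = begin
    ψ (suc a′) ℤ.- ⟦ a ≟ k ⟧ ℤ.* ψ (suc a′) ≡⟨ x-⟦no⟧*y≡x (a ≟ k) (<⇒≢ a<k) (ψ (suc a′)) (ψ (suc a′)) ⟩
    ψ (suc a′)                              ≡⟨ cong (ψ ∘ suc) (whirlCentre-< m a<k) ⟩
    ψ (suc (suc a))                         ∎
    where a′ = whirlCentre k a m
  ... | inj₂ refl = trans (x-⟦yes⟧*x≡0 (a ≟ a) refl (ψ (suc (whirlCentre a a m)))) (sym ψ[2+k]≡0)

  potential-whirl : ∀ {k f} → ψ (suc (suc k)) ≡ + 0 → IsLabelling k f → ¬ Double (whirl k f) →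
    potential (whirl k f) ≡ potential f ℤ.+ K ℤ.* hits i f ℤ.- + 3
  potential-whirl {k} {f} ψ[2+k]≡0 lab ¬double = begin
    potential (whirl k f)
      ≡⟨ collect-centre (ψ b′) (ψ d′) X ⟦ b′ ≟ a′ ⟧ ⟦ d′ ≟ a′ ⟧ ⟩
    ψ b′ ℤ.+ ψ d′ ℤ.+ (X ℤ.- (⟦ b′ ≟ a′ ⟧ ℤ.+ ⟦ d′ ≟ a′ ⟧) ℤ.* X)
      ≡⟨ cong (λ e → ψ b′ ℤ.+ ψ d′ ℤ.+ (X ℤ.- e ℤ.* X)) (centre-wraps-once lab ¬double) ⟨
    ψ b′ ℤ.+ ψ d′ ℤ.+ (X ℤ.- ⟦ a ≟ k ⟧ ℤ.* X)
      ≡⟨ cong₂ ℤ._+_ (cong₂ ℤ._+_ (ψ-whirlLeaf (leaf≤centre ℓ⋗c)) (ψ-whirlLeaf (leaf≤centre r⋗c)))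
                     (ψ-whirlCentre _ ψ[2+k]≡0 centre≤k) ⟩
    (ψ (suc b) ℤ.- ⟦ b ≟ a ⟧ ℤ.* Y) ℤ.+ (ψ (suc d) ℤ.- ⟦ d ≟ a ⟧ ℤ.* Y) ℤ.+ ψ (suc (suc a))
      ≡⟨ cong₂ ℤ._+_ (cong₂ ℤ._+_ (cong (ℤ._- ⟦ b ≟ a ⟧ ℤ.* Y) (ψ-suc b))
                                  (cong (ℤ._- ⟦ d ≟ a ⟧ ℤ.* Y) (ψ-suc d)))
                     (ψ-suc (suc a)) ⟩
    (ψ b ℤ.+ K ℤ.* ⟦ b ≟ i ⟧ ℤ.- + 1 ℤ.- ⟦ b ≟ a ⟧ ℤ.* Y)
      ℤ.+ (ψ d ℤ.+ K ℤ.* ⟦ d ≟ i ⟧ ℤ.- + 1 ℤ.- ⟦ d ≟ a ⟧ ℤ.* Y)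
      ℤ.+ (Y ℤ.+ K ℤ.* ⟦ suc a ≟ i ⟧ ℤ.- + 1)
      ≡⟨ collect-steps K (ψ b) (ψ d) Y ⟦ b ≟ a ⟧ ⟦ d ≟ a ⟧ ⟦ b ≟ i ⟧ ⟦ d ≟ i ⟧ ⟦ suc a ≟ i ⟧ ⟩
    potential f ℤ.+ K ℤ.* hits i f ℤ.- + 3 ∎
    where
      open IsLabelling lab
      a = f c
      b = f ℓ
      d = f r
      a′ = whirl k f c
      b′ = whirl k f ℓ
      d′ = whirl k f r
      X = ψ (suc a′)
      Y = ψ (suc a)
      collect-centre : ∀ (B D X Eb Ed : ℤ) →
        (B ℤ.- Eb ℤ.* X) ℤ.+ (D ℤ.- Ed ℤ.* X) ℤ.+ X ≡ B ℤ.+ D ℤ.+ (X ℤ.- (Eb ℤ.+ Ed) ℤ.* X)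
      collect-centre = solve-∀
      collect-steps : ∀ (K B D Y Eb Ed Hb Hd Hc : ℤ) →
        (B ℤ.+ K ℤ.* Hb ℤ.- + 1 ℤ.- Eb ℤ.* Y) ℤ.+ (D ℤ.+ K ℤ.* Hd ℤ.- + 1 ℤ.- Ed ℤ.* Y)
          ℤ.+ (Y ℤ.+ K ℤ.* Hc ℤ.- + 1)
          ≡ (B ℤ.- Eb ℤ.* Y) ℤ.+ (D ℤ.- Ed ℤ.* Y) ℤ.+ Y ℤ.+ K ℤ.* (Hb ℤ.+ Hd ℤ.+ Hc) ℤ.- + 3
      collect-steps = solve-∀

ψ-vanishes : ∀ {k i} → i ≤ suc k → Potential.ψ (+ (k + 2)) i (suc (suc k)) ≡ + 0
ψ-vanishes {k} {i} i≤1+k = begin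
  K ℤ.* ⟦ i <? 2 + k ⟧ ℤ.- + (2 + k)
    ≡⟨ cong (λ e → K ℤ.* e ℤ.- + (2 + k)) (⟦⟧-yes (i <? 2 + k) (s≤s i≤1+k)) ⟩
  K ℤ.* + 1 ℤ.- + (2 + k)
    ≡⟨ cong₂ ℤ._-_ (ZP.*-identityʳ K) (cong +_ (+-comm 2 k)) ⟩
  K ℤ.- K
    ≡⟨ ZP.+-inverseʳ K ⟩
  + 0 ∎
  where K = + (k + 2)

sumℤ-telescoping : ∀ (K : ℤ) (P s : ℕ → ℤ) (d n : ℕ) →
  (∀ t → t < n → P (suc t) ≡ P t ℤ.+ K ℤ.* s t ℤ.- + d) →
  K ℤ.* sumℤ n s ℤ.+ P 0 ≡ + (d * n) ℤ.+ P n
sumℤ-telescoping K P s d zero _ =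
  trans (cong (ℤ._+ P 0) (ZP.*-zeroʳ K)) (cong (λ m → + m ℤ.+ P 0) (sym (*-zeroʳ d)))
sumℤ-telescoping K P s d (suc n) step = begin
  K ℤ.* (sumℤ n s ℤ.+ s n) ℤ.+ P 0
    ≡⟨ shift K (sumℤ n s) (s n) (P 0) ⟩
  K ℤ.* sumℤ n s ℤ.+ P 0 ℤ.+ K ℤ.* s n
    ≡⟨ cong (ℤ._+ K ℤ.* s n) (sumℤ-telescoping K P s d n (λ t t<n → step t (m<n⇒m<1+n t<n))) ⟩
  + (d * n) ℤ.+ P n ℤ.+ K ℤ.* s n
    ≡⟨ regroup (+ d) (+ (d * n)) (P n) (K ℤ.* s n) ⟩
  (+ d ℤ.+ + (d * n)) ℤ.+ (P n ℤ.+ K ℤ.* s n ℤ.- + d)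
    ≡⟨ cong₂ ℤ._+_ (trans (sym (ZP.pos-+ d (d * n))) (cong +_ (sym (*-suc d n)))) (sym (step n ≤-refl)) ⟩
  + (d * suc n) ℤ.+ P (suc n) ∎
  where
    shift : ∀ (K Σ x P₀ : ℤ) → K ℤ.* (Σ ℤ.+ x) ℤ.+ P₀ ≡ K ℤ.* Σ ℤ.+ P₀ ℤ.+ K ℤ.* x
    shift = solve-∀
    regroup : ∀ (D Σ P y : ℤ) → Σ ℤ.+ P ℤ.+ y ≡ (D ℤ.+ Σ) ℤ.+ (P ℤ.+ y ℤ.- D)
    regroup = solve-∀

cover⇒Touches : ∀ {k I N t x} → t < N → CoversV x c → row k I t x ≡ row k I t c → Touches k I N (c , t) x
cover⇒Touches {t = t} t<N x⋗c x≡c = t , t<N , bwd (cover t<N x⋗c x≡c) ◅ ε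

OneTailed⇒¬Double : ∀ {k I N t} → t < N → OneTailed k I N (c , t) → ¬ Double (row k I t)
OneTailed⇒¬Double t<N (inj₁ (_ , ¬touches-r)) (_ , r≡c) = ¬touches-r (cover⇒Touches t<N r⋗c r≡c)
OneTailed⇒¬Double t<N (inj₂ (¬touches-ℓ , _)) (ℓ≡c , _) = ¬touches-ℓ (cover⇒Touches t<N ℓ⋗c ℓ≡c)

module _ {k} {I : Subset k} (ideal : IsOrderIdeal k I) where

  row-invariant : ∀ t → Represents k (ρ^ k t I) (row k I t) × IsLabelling k (row k I t)
  row-invariant zero    = ideal⇒Represents ideal , ideal⇒IsLabelling ideal
  row-invariant (suc t) =
    Represents-≗ w≗row (rowmotion-Represents lab rep) , IsLabelling-≗ w≗row (whirl-IsLabelling lab)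
    where
      rep = proj₁ (row-invariant t)
      lab = proj₂ (row-invariant t)
      w≗row : whirl k (row k I t) ≗ row k I (suc t)
      w≗row x = sym (φ⁻¹-rowmotion rep lab x)

  row-suc : ∀ t → row k I (suc t) ≗ whirl k (row k I t)
  row-suc t = φ⁻¹-rowmotion (proj₁ (row-invariant t)) (proj₂ (row-invariant t))

module _ {k} {I : Subset k} {N} (ρᴺI≈I : ρ^ k N I ≈ I) (one-tailed : AllOneTailed k I N) where

  ¬Double-row-suc : ∀ t → t < N → ¬ Double (row k I (suc t))
  ¬Double-row-suc t t<N with suc t <? N
  ... | yes 1+t<N = OneTailed⇒¬Double 1+t<N (one-tailed c (suc t) 1+t<N)
  ... | no  1+t≮N = OneTailed⇒¬Double 0<N (one-tailed c 0 0<N) ∘ Double-≗ row[1+t]≗row₀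
    where
      0<N = ≤-trans (s≤s z≤n) t<N
      row[1+t]≗row₀ : row k I (suc t) ≗ row k I 0
      row[1+t]≗row₀ x = trans (cong (λ n → row k I n x) (≤-antisym t<N (≮⇒≥ 1+t≮N))) (φ⁻¹-cong ρᴺI≈I x)

lemma3p18 : (k : ℕ) → 1 ≤ k →
    (I : Subset k) → IsOrderIdeal k I →
    (N : ℕ) → IsOrbitSize k I N →
    AllOneTailed k I N →
    (i : ℕ) → 2 ≤ i → i ≤ k ∸ 1 →
    (+ (k + 2)) ℤ.* sumℤ N (λ t → (+ F k i (ρ^ k t I)) ℤ.- (+ F k (i + 1) (ρ^ k t I)))
      ≡ + (3 * N)
lemma3p18 k _ I ideal N (_ , ρᴺI≈I , _) one-tailed i 2≤i i≤k∸1 =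
  ∙-cancelʳ (P 0) (K ℤ.* sumℤ N s) (+ (3 * N)) (begin
    K ℤ.* sumℤ N s ℤ.+ P 0  ≡⟨ sumℤ-telescoping K P s 3 N step ⟩
    + (3 * N) ℤ.+ P N       ≡⟨ cong (λ p → + (3 * N) ℤ.+ p) (potential-≗ (φ⁻¹-cong ρᴺI≈I)) ⟩
    + (3 * N) ℤ.+ P 0       ∎)
  where
    K = + (k + 2)
    open Potential K i
    s : ℕ → ℤ
    s t = + F k i (ρ^ k t I) ℤ.- + F k (i + 1) (ρ^ k t I)
    P : ℕ → ℤ
    P t = potential (row k I t)
    ψ[2+k]≡0 : ψ (2 + k) ≡ + 0
    ψ[2+k]≡0 = ψ-vanishes (≤-trans i≤k∸1 (≤-trans (m∸n≤m k 1) (n≤1+n k)))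
    step : ∀ t → t < N → P (suc t) ≡ P t ℤ.+ K ℤ.* s t ℤ.- + 3
    step t t<N = begin
      potential (row k I (suc t))               ≡⟨ potential-≗ (row-suc ideal t) ⟩
      potential (whirl k (row k I t))           ≡⟨ potential-whirl ψ[2+k]≡0 lab ¬double ⟩
      P t ℤ.+ K ℤ.* hits i (row k I t) ℤ.- + 3  ≡⟨ cong (λ h → P t ℤ.+ K ℤ.* h ℤ.- + 3) F-diff ⟨
      P t ℤ.+ K ℤ.* s t ℤ.- + 3                 ∎
      where
        rep = proj₁ (row-invariant ideal t)
        lab = proj₂ (row-invariant ideal t)
        ¬double = ¬Double-row-suc ρᴺI≈I one-tailed t t<N ∘ Double-≗ (sym ∘ row-suc ideal t)
        F-diff = F-difference rep lab 2≤i
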